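{- Let $n\ge2$, let $\varphi_1(\mathbf{x},\mathbf{y})$ be a smallest propagation complete encoding of $\mathrm{AMO}_n(\mathbf{x})$ and let $\varphi_2(\mathbf{x},\mathbf{z})$ be a smallest propagation complete encoding of $\mathrm{EO}_n(\mathbf{x})$. Then $S(n)\le|\varphi_1|\le S(n)+1$ and $S(n)\le|\varphi_2|\le S(n)+1$, where $S(n)$ is the minimum size of a P-encoding with $n$ input variables.
   Context: A CNF formula is a conjunction of clauses (disjunctions of literals with no complementary pair); its size $|\varphi|$ is its number of clauses. Unit resolution: from a unit clause $l$ and a clause containing $\neg l$ derive the clause with $\neg l$ removed; $\varphi\wedge g_1\wedge\dots\wedge g_p\vdash_1 C$ means $C$ is derivable from $\varphi$ and the unit clauses $g_i$ by a sequence of unit resolutions, and $\vdash_1\bot$ means the empty clause is derivable. $\mathrm{AMO}_n(x_1,\dots,x_n)=1$ iff at most one $x_i$ is $1$; $\mathrm{EO}_n(x_1,\dots,x_n)=1$ iff exactly one $x_i$ is $1$. A CNF $\varphi(\mathbf{x},\mathbf{y})$ with input variables $\mathbf{x}=(x_1,\dots,x_n)$, auxiliary variables $\mathbf{y}=(y_1,\dots,y_\ell)$ is an encoding of $f(\mathbf{x})$ if for all $\alpha\in\{0,1\}^n$: $f(\alpha)=1$ iff $\exists\beta\in\{0,1\}^\ell$ with $\varphi(\alpha,\beta)=1$. It is a propagation complete encoding of $f$ if moreover for all literals $g_1,\dots,g_p$ ($p\ge1$) and $h$ on input variables with $f\wedge\bigwedge_i g_i\models h$, we have $\varphi\wedge\bigwedge_i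 g_i\vdash_1 h$ or $\varphi\wedge\bigwedge_i g_i\vdash_1\bot$. A CNF formula $\varphi(\mathbf{x},\mathbf{y})$ with input variables $x_1,\dots,x_n$ is a P-encoding if (P1) $\varphi\wedge x_i$ is satisfiable for each $i$ and (P2) $\varphi\wedge x_i\vdash_1\neg x_j$ for all $i\ne j$. -}

module Defs where

open import Data.Nat using (ℕ; suc; _≤_; _≤ᵇ_; _≡ᵇ_)
open import Data.Bool using (Bool; true; false; not; if_then_else_)
import Data.Bool.Properties as BoolP
open import Data.Fin using (Fin)
import Data.Fin.Properties as FinP
open import Data.Sum using (_⊎_; inj₁; inj₂; [_,_])
import Data.Sum.Properties as SumP
open import Data.Product using (_×_; _,_; ∃; ∃-syntax; Σ-syntax)
import Data.Product.Properties as ProdP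
open import Data.List using (List; []; _∷_; _++_; map; filter; length; allFin)
open import Data.Nat.ListAction using (sum)
open import Data.List.Membership.Propositional using (_∈_)
open import Data.List.Relation.Unary.All using (All)
open import Data.List.Relation.Unary.Any using (Any)
open import Relation.Nullary using (¬_; ¬?)
open import Relation.Binary using (DecidableEquality)
open import Relation.Binary.PropositionalEquality using (_≡_; _≢_)
open import Function.Bundles using (_⇔_)

-- Variables of a formula with n input variables and ℓ auxiliary ones:
-- inj₁ i is the input variable x_i, inj₂ j is the auxiliary variable y_j.
Var : ℕ → ℕ → Set
Var n ℓ = Fin n ⊎ Fin ℓ

-- A literal is a variable with a polarity: (v , true) is v, (v , false) is ¬v.
Lit : Set → Set
Lit V = V × Bool

negLit : {V : Set} → Lit V → Lit V
negLit (v , b) = (v , not b)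

Clause : Set → Set
Clause V = List (Lit V)

-- A CNF is a list of clauses; its size |φ| is its number of clauses (length).
CNF : Set → Set
CNF V = List (Clause V)

WellFormed : {V : Set} → CNF V → Set
WellFormed {V} φ = All (λ C → (v : V) → ¬ (((v , true) ∈ C) × ((v , false) ∈ C))) φ

LitTrue : {V : Set} → (V → Bool) → Lit V → Set
LitTrue a (v , b) = a v ≡ b

ClauseTrue : {V : Set} → (V → Bool) → Clause V → Set
ClauseTrue a C = Any (LitTrue a) C

CNFTrue : {V : Set} → (V → Bool) → CNF V → Set
CNFTrue a φ = All (ClauseTrue a) φ

module _ {n ℓ : ℕ} where

  _≟ᴸ_ : DecidableEquality (Lit (Var n ℓ))
  _≟ᴸ_ = ProdP.≡-dec (SumP.≡-dec FinP._≟_ FinP._≟_) BoolP._≟_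

  removeLit : Lit (Var n ℓ) → Clause (Var n ℓ) → Clause (Var n ℓ)
  removeLit l C = filter (λ m → ¬? (m ≟ᴸ l)) C

  IsUnit : Clause (Var n ℓ) → Lit (Var n ℓ) → Set
  IsUnit C l = (m : Lit (Var n ℓ)) → (m ∈ C) ⇔ (m ≡ l)

  data _⊢ᵘ_ (φ : CNF (Var n ℓ)) : Clause (Var n ℓ) → Set where
    axiom   : {C : Clause (Var n ℓ)} → C ∈ φ → φ ⊢ᵘ C
    resolve : {U C : Clause (Var n ℓ)} {l : Lit (Var n ℓ)} →
              φ ⊢ᵘ U → IsUnit U l → φ ⊢ᵘ C → negLit l ∈ C →
              φ ⊢ᵘ removeLit (negLit l) C

  _⊢₁_ : CNF (Var n ℓ) → Lit (Var n ℓ) → Set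
  φ ⊢₁ h = ∃[ C ] ((φ ⊢ᵘ C) × IsUnit C h)

  _⊢₁⊥ : CNF (Var n ℓ) → Set
  φ ⊢₁⊥ = φ ⊢ᵘ []

  withUnits : CNF (Var n ℓ) → List (Lit (Var n ℓ)) → CNF (Var n ℓ)
  withUnits φ gs = φ ++ map (λ g → g ∷ []) gs

ILit : ℕ → Set
ILit n = Lit (Fin n)

liftLit : {n ℓ : ℕ} → ILit n → Lit (Var n ℓ)
liftLit (i , b) = (inj₁ i , b)

IsEncoding : {n ℓ : ℕ} → ((Fin n → Bool) → Bool) → CNF (Var n ℓ) → Set
IsEncoding {n} {ℓ} f φ =
  WellFormed φ ×
  ((α : Fin n → Bool) → (f α ≡ true) ⇔ (∃[ β ] CNFTrue [ α , β ] φ))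

IsPCEncoding : {n ℓ : ℕ} → ((Fin n → Bool) → Bool) → CNF (Var n ℓ) → Set
IsPCEncoding {n} {ℓ} f φ =
  IsEncoding f φ ×
  ((gs : List (ILit n)) → gs ≢ [] → (h : ILit n) →
   ((α : Fin n → Bool) → f α ≡ true → All (LitTrue α) gs → LitTrue α h) →
   (withUnits φ (map liftLit gs) ⊢₁ liftLit h) ⊎ (withUnits φ (map liftLit gs) ⊢₁⊥))

IsSmallestPCEncoding : {n ℓ : ℕ} → ((Fin n → Bool) → Bool) → CNF (Var n ℓ) → Set
IsSmallestPCEncoding {n} {ℓ} f φ =
  IsPCEncoding f φ ×
  ((ℓ' : ℕ) (ψ : CNF (Var n ℓ')) → IsPCEncoding f ψ → length φ ≤ length ψ)

IsPEncoding : {n ℓ : ℕ} → CNF (Var n ℓ) → Set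
IsPEncoding {n} {ℓ} φ =
  WellFormed φ ×
  ((i : Fin n) → ∃[ a ] CNFTrue a (withUnits φ ((inj₁ i , true) ∷ []))) ×
  ((i j : Fin n) → i ≢ j → withUnits φ ((inj₁ i , true) ∷ []) ⊢₁ (inj₁ j , false))

IsMinPEncodingSize : ℕ → ℕ → Set
IsMinPEncodingSize n s =
  (∃[ ℓ ] Σ[ φ ∈ CNF (Var n ℓ) ] (IsPEncoding φ × length φ ≡ s)) ×
  ((ℓ : ℕ) (φ : CNF (Var n ℓ)) → IsPEncoding φ → s ≤ length φ)

countTrue : {n : ℕ} → (Fin n → Bool) → ℕ
countTrue {n} α = sum (map (λ i → if α i then 1 else 0) (allFin n))

AMO : (n : ℕ) → (Fin n → Bool) → Bool
AMO n α = countTrue α ≤ᵇ 1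

EO : (n : ℕ) → (Fin n → Bool) → Bool
EO n α = countTrue α ≡ᵇ 1

module Submission where

-- Lower bound. AMO_n and EO_n both accept every unit vector e_i and only vectors with at most
-- one 1 ("sandwiched" functions). A PC encoding φ of such an f is a P-encoding: e_i extends to
-- a model of φ ∧ x_i, and f ∧ x_i ⊨ ¬x_j forces φ ∧ x_i ⊢₁ ¬x_j, a conflict being excluded
-- by soundness of unit resolution.
--
-- Upper bound. Let ψ be a P-encoding of minimum size. For any encoding φ with the P2 property,
-- a sandwiched f entailing h from assumptions containing some x_i is handled by P2 alone
-- (pc-criterion); only purely negative assumptions need a function-specific argument.
-- ψ ∧ (x_1 ∨ … ∨ x_n) is then a PC encoding of EO_n, and renaming x_0 in ψ to a fresh y_0
-- and adding ¬x_0 ∨ y_0 gives a PC encoding of AMO_n; both have |ψ| + 1 clauses.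

open import Defs
open import Data.Nat using (ℕ; zero; suc; _≤_; _+_; z≤n; s≤s)
open import Data.Nat.Properties using (≤-trans; ≤-reflexive; ≤-antisym; m≤n+m; +-comm; 1+n≰n; ≤ᵇ⇒≤; ≤⇒≤ᵇ; ≡ᵇ⇒≡; ≡⇒≡ᵇ)
open import Data.Nat.ListAction using (sum)
open import Data.Bool using (Bool; true; false; not; if_then_else_)
open import Data.Bool.Properties using (not-¬; ¬-not; T-≡) renaming (_≟_ to _≟ᵇ_)
open import Data.Fin using (Fin; zero; suc)
open import Data.Fin.Properties using (suc-injective) renaming (any? to anyFin?; _≟_ to _≟ᶠ_)
open import Data.Sum using (_⊎_; inj₁; inj₂; [_,_])
open import Data.Product using (_×_; _,_; ∃-syntax; Σ-syntax; proj₁; proj₂)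
open import Data.Product.Properties using (≡-dec)
open import Data.List using (List; []; _∷_; _++_; map; length; tabulate; allFin)
open import Data.List.Properties using (length-++; length-map; map-tabulate)
open import Data.List.Membership.Propositional using (_∈_; _∉_; find; lose)
open import Data.List.Membership.Propositional.Properties
  using (∈-filter⁺; ∈-filter⁻; ∈-map⁺; ∈-map⁻; ∈-++⁺ˡ; ∈-++⁺ʳ; ∈-++⁻; ∈-allFin)
import Data.List.Membership.DecPropositional as DecMembership
open import Data.List.Relation.Unary.All as All using (All; []; _∷_; all?)
import Data.List.Relation.Unary.All.Properties as All
open import Data.List.Relation.Unary.All.Properties.Core using (¬All⇒Any¬; ¬Any⇒All¬)
open import Data.List.Relation.Unary.Any as Any using (Any; here; there; any?)
import Data.List.Relation.Unary.Any.Properties as Any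
open import Function using (_∘_)
open import Function.Bundles using (_⇔_; mk⇔; Equivalence)
open import Relation.Nullary using (¬_; ¬?; Dec; yes; no; does; contradiction)
open import Relation.Nullary.Decidable using (dec-true; dec-false)
open import Relation.Binary.PropositionalEquality using (_≡_; _≢_; _≗_; refl; sym; trans; cong; cong₂; subst)

litTrue-negLit : {V : Set} (a : V → Bool) (l : Lit V) → LitTrue a l → ¬ LitTrue a (negLit l)
litTrue-negLit a (v , b) = not-¬

CNFTrue-cong : {V : Set} {a b : V → Bool} → a ≗ b → (φ : CNF V) → CNFTrue a φ → CNFTrue b φ
CNFTrue-cong a≗b φ = All.map (Any.map λ { {v , c} p → trans (sym (a≗b v)) p })

no-members⇒[] : {A : Set} (xs : List A) → (∀ {x} → x ∉ xs) → xs ≡ []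
no-members⇒[] []      _     = refl
no-members⇒[] (x ∷ _) empty = contradiction (here refl) empty

length-snoc : {A : Set} (xs : List A) (x : A) → length (xs ++ x ∷ []) ≡ suc (length xs)
length-snoc xs x = trans (length-++ xs) (+-comm (length xs) 1)

module _ {n ℓ : ℕ} where

  private
    L : Set
    L = Lit (Var n ℓ)

  unit-singleton : (l : L) → IsUnit (l ∷ []) l
  unit-singleton l m = mk⇔ (λ { (here m≡l) → m≡l ; (there ()) }) here

  ∈-removeLit⁺ : {k m : L} {C : Clause (Var n ℓ)} → m ∈ C → m ≢ k → m ∈ removeLit k C
  ∈-removeLit⁺ {k} = ∈-filter⁺ (λ m → ¬? (m ≟ᴸ k))

  ∈-removeLit⁻ : {k m : L} {C : Clause (Var n ℓ)} → m ∈ removeLit k C → m ∈ C × m ≢ k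
  ∈-removeLit⁻ {k} = ∈-filter⁻ (λ m → ¬? (m ≟ᴸ k))

  removeLit-hit : (k : L) (C : Clause (Var n ℓ)) → removeLit k (k ∷ C) ≡ removeLit k C
  removeLit-hit k C with k ≟ᴸ k
  ... | yes _   = refl
  ... | no k≢k = contradiction refl k≢k

  removeLit-miss : (k m : L) (C : Clause (Var n ℓ)) → m ≢ k → removeLit k (m ∷ C) ≡ m ∷ removeLit k C
  removeLit-miss k m C m≢k with m ≟ᴸ k
  ... | yes m≡k = contradiction m≡k m≢k
  ... | no _    = refl

  removeLit-unit : {U : Clause (Var n ℓ)} {l : L} → IsUnit U l → removeLit l U ≡ []
  removeLit-unit {U} {l} unit = no-members⇒[] (removeLit l U) λ m∈ →
    let (m∈U , m≢l) = ∈-removeLit⁻ m∈ in m≢l (Equivalence.to (unit _) m∈U)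

  sound : {a : Var n ℓ → Bool} {φ : CNF (Var n ℓ)} → CNFTrue a φ →
          {C : Clause (Var n ℓ)} → φ ⊢ᵘ C → ClauseTrue a C
  sound t (axiom C∈φ) = All.lookup t C∈φ
  sound {a} t (resolve {l = l} dU unit dC ¬l∈C) with find (sound t dU) | find (sound t dC)
  ... | u , u∈U , u-true | m , m∈C , m-true = lose (∈-removeLit⁺ m∈C m≢¬l) m-true
    where
    m≢¬l : m ≢ negLit l
    m≢¬l m≡¬l = litTrue-negLit a l (subst (LitTrue a) (Equivalence.to (unit u) u∈U) u-true)
                  (subst (LitTrue a) m≡¬l m-true)

  sound-⊥ : {a : Var n ℓ → Bool} {φ : CNF (Var n ℓ)} → CNFTrue a φ → ¬ (φ ⊢₁⊥)
  sound-⊥ t d with () ← sound t d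

  sound-lit : {a : Var n ℓ → Bool} {φ : CNF (Var n ℓ)} → CNFTrue a φ → {h : L} → φ ⊢₁ h → LitTrue a h
  sound-lit {a} t (U , dU , unit) with find (sound t dU)
  ... | u , u∈U , u-true = subst (LitTrue a) (Equivalence.to (unit u) u∈U) u-true

  ⊢ᵘ-compose : {φ ψ : CNF (Var n ℓ)} → (∀ {C} → C ∈ φ → ψ ⊢ᵘ C) → {D : Clause (Var n ℓ)} → φ ⊢ᵘ D → ψ ⊢ᵘ D
  ⊢ᵘ-compose base (axiom C∈φ)         = base C∈φ
  ⊢ᵘ-compose base (resolve dU u dC m) = resolve (⊢ᵘ-compose base dU) u (⊢ᵘ-compose base dC) m

  ⊢₁-compose : {φ ψ : CNF (Var n ℓ)} → (∀ {C} → C ∈ φ → ψ ⊢ᵘ C) → {h : L} → φ ⊢₁ h → ψ ⊢₁ h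
  ⊢₁-compose base (U , dU , unit) = U , ⊢ᵘ-compose base dU , unit

  ⊢₁-weaken : {φ ψ : CNF (Var n ℓ)} → (∀ {C} → C ∈ φ → C ∈ ψ) → {h : L} → φ ⊢₁ h → ψ ⊢₁ h
  ⊢₁-weaken φ⊆ψ = ⊢₁-compose (axiom ∘ φ⊆ψ)

  clash : {Δ : CNF (Var n ℓ)} {l : L} → Δ ⊢₁ l → Δ ⊢₁ negLit l → Δ ⊢₁⊥
  clash {Δ} (U , dU , uU) (V , dV , uV) =
    subst (Δ ⊢ᵘ_) (removeLit-unit uV) (resolve dU uU dV (Equivalence.from (uV _) refl))

  resolveAway : {φ : CNF (Var n ℓ)} {C : Clause (Var n ℓ)} → φ ⊢ᵘ C →
                {ls : List L} → All (φ ⊢₁_) ls →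
                ∃[ C' ] (φ ⊢ᵘ C' × (∀ {m} → m ∈ C' → m ∈ C × All (λ l → m ≢ negLit l) ls))
  resolveAway {C = C} d [] = C , d , λ m∈C → m∈C , []
  resolveAway d {l ∷ ls} ((U , dU , unit) ∷ dls) with resolveAway d dls
  ... | C' , d' , sub with negLit l ∈? C'
    where open DecMembership (_≟ᴸ_ {n} {ℓ}) using (_∈?_)
  ... | no ¬l∉C' = C' , d' , λ m∈C' →
        proj₁ (sub m∈C') , (λ m≡¬l → ¬l∉C' (subst (_∈ C') m≡¬l m∈C')) ∷ proj₂ (sub m∈C')
  ... | yes ¬l∈C' = removeLit (negLit l) C' , resolve dU unit d' ¬l∈C' , λ m∈ →
        let (m∈C' , m≢¬l) = ∈-removeLit⁻ m∈ in proj₁ (sub m∈C') , m≢¬l ∷ proj₂ (sub m∈C')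

  derived-unit-or-empty : {φ : CNF (Var n ℓ)} {C : Clause (Var n ℓ)} {h : L} → φ ⊢ᵘ C →
                          (∀ {m} → m ∈ C → m ≡ h) → (φ ⊢₁ h) ⊎ (φ ⊢₁⊥)
  derived-unit-or-empty {C = []}    d _    = inj₂ d
  derived-unit-or-empty {C = m ∷ C} d all≡ = inj₁ (m ∷ C , d , λ m' →
    mk⇔ all≡ λ { refl → subst (_∈ m ∷ C) (all≡ (here refl)) (here refl) })

module Rename {n ℓ n' ℓ' : ℕ} (ρ : Var n ℓ → Var n' ℓ') (ρ-inj : ∀ {u v} → ρ u ≡ ρ v → u ≡ v) where

  renLit : Lit (Var n ℓ) → Lit (Var n' ℓ')
  renLit (v , b) = (ρ v , b)

  renClause : Clause (Var n ℓ) → Clause (Var n' ℓ')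
  renClause = map renLit

  renCNF : CNF (Var n ℓ) → CNF (Var n' ℓ')
  renCNF = map renClause

  renLit-inj : ∀ {l m} → renLit l ≡ renLit m → l ≡ m
  renLit-inj {u , b} {v , c} eq with refl ← ρ-inj (cong proj₁ eq) | refl ← cong proj₂ eq = refl

  renClause-removeLit : (k : Lit (Var n ℓ)) (C : Clause (Var n ℓ)) →
                        renClause (removeLit k C) ≡ removeLit (renLit k) (renClause C)
  renClause-removeLit k []      = refl
  renClause-removeLit k (m ∷ C) with m ≟ᴸ k
  ... | yes refl = sym (trans (removeLit-hit (renLit k) (renClause C)) (sym (renClause-removeLit k C)))
  ... | no m≢k  = sym (trans (removeLit-miss (renLit k) (renLit m) (renClause C) (m≢k ∘ renLit-inj))
                             (cong (renLit m ∷_) (sym (renClause-removeLit k C))))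

  renClause-unit : {U : Clause (Var n ℓ)} {l : Lit (Var n ℓ)} → IsUnit U l → IsUnit (renClause U) (renLit l)
  renClause-unit {U} {l} unit m = mk⇔
    (λ m∈ → let (u , u∈U , m≡) = ∈-map⁻ renLit m∈ in trans m≡ (cong renLit (Equivalence.to (unit u) u∈U)))
    (λ { refl → ∈-map⁺ renLit (Equivalence.from (unit l) refl) })

  rename-⊢ᵘ : {φ : CNF (Var n ℓ)} {C : Clause (Var n ℓ)} → φ ⊢ᵘ C → renCNF φ ⊢ᵘ renClause C
  rename-⊢ᵘ (axiom C∈φ) = axiom (∈-map⁺ renClause C∈φ)
  rename-⊢ᵘ {φ} (resolve {C = C} {l = v , b} dU unit dC ¬l∈C) =
    subst (renCNF φ ⊢ᵘ_) (sym (renClause-removeLit (v , not b) C))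
      (resolve (rename-⊢ᵘ dU) (renClause-unit unit) (rename-⊢ᵘ dC) (∈-map⁺ renLit ¬l∈C))

  rename-⊢₁ : {φ : CNF (Var n ℓ)} {h : Lit (Var n ℓ)} → φ ⊢₁ h → renCNF φ ⊢₁ renLit h
  rename-⊢₁ (U , dU , unit) = renClause U , rename-⊢ᵘ dU , renClause-unit unit

  rename-sat⁺ : (a : Var n' ℓ' → Bool) {φ : CNF (Var n ℓ)} → CNFTrue (a ∘ ρ) φ → CNFTrue a (renCNF φ)
  rename-sat⁺ a t = All.map⁺ (All.map (Any.map⁺ ∘ Any.map λ { {v , b} p → p }) t)

  rename-sat⁻ : (a : Var n' ℓ' → Bool) {φ : CNF (Var n ℓ)} → CNFTrue a (renCNF φ) → CNFTrue (a ∘ ρ) φ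
  rename-sat⁻ a t = All.map (Any.map (λ { {v , b} p → p }) ∘ Any.map⁻) (All.map⁻ t)

  rename-wellFormed : {φ : CNF (Var n ℓ)} → WellFormed φ → WellFormed (renCNF φ)
  rename-wellFormed wf = All.map⁺ (All.map noClash wf)
    where
    noClash : {C : Clause (Var n ℓ)} → ((v : Var n ℓ) → ¬ ((v , true) ∈ C × (v , false) ∈ C)) →
              (v : Var n' ℓ') → ¬ ((v , true) ∈ renClause C × (v , false) ∈ renClause C)
    noClash wfC v (pos , neg) with ∈-map⁻ renLit pos | ∈-map⁻ renLit neg
    ... | (u , true) , u∈ , refl | (u' , false) , u'∈ , eq with refl ← ρ-inj (cong proj₁ eq) = wfC u (u∈ , u'∈)

unitVec : {n : ℕ} → Fin n → Fin n → Bool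
unitVec i k = does (k ≟ᶠ i)

unitVec-self : {n : ℕ} (i : Fin n) → unitVec i i ≡ true
unitVec-self i = dec-true (i ≟ᶠ i) refl

unitVec-true⇒ : {n : ℕ} {i k : Fin n} → unitVec i k ≡ true → k ≡ i
unitVec-true⇒ {i = i} {k} eq with k ≟ᶠ i
... | yes k≡i = k≡i
unitVec-true⇒ () | no _

OnlyAt : {n : ℕ} → (Fin n → Bool) → Fin n → Set
OnlyAt α i = α i ≡ true × (∀ k → k ≢ i → α k ≡ false)

unitVec-onlyAt : {n : ℕ} (i : Fin n) → OnlyAt (unitVec i) i
unitVec-onlyAt i = unitVec-self i , λ k → dec-false (k ≟ᶠ i)

onlyAt-unique : {n : ℕ} {α γ : Fin n → Bool} {i : Fin n} → OnlyAt α i → OnlyAt γ i → α ≗ γ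
onlyAt-unique {i = i} (αi , α-rest) (γi , γ-rest) k with k ≟ᶠ i
... | yes refl = trans αi (sym γi)
... | no k≢i   = trans (α-rest k k≢i) (sym (γ-rest k k≢i))

someTrue? : {n : ℕ} (α : Fin n → Bool) → (∃[ i ] α i ≡ true) ⊎ (∀ i → α i ≡ false)
someTrue? α with anyFin? (λ i → α i ≟ᵇ true)
... | yes some = inj₁ some
... | no none  = inj₂ λ i → ¬-not λ αi → none (i , αi)

bit : Bool → ℕ
bit b = if b then 1 else 0

countTrue-suc : {n : ℕ} (α : Fin (suc n) → Bool) → countTrue α ≡ bit (α zero) + countTrue (α ∘ suc)
countTrue-suc α = cong (bit (α zero) +_) (cong sum
  (trans (map-tabulate suc (bit ∘ α)) (sym (map-tabulate (λ k → k) (bit ∘ α ∘ suc)))))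

countTrue-none : {n : ℕ} (α : Fin n → Bool) → (∀ k → α k ≡ false) → countTrue α ≡ 0
countTrue-none {zero}  α _    = refl
countTrue-none {suc n} α none =
  trans (countTrue-suc α) (cong₂ _+_ (cong bit (none zero)) (countTrue-none (α ∘ suc) (none ∘ suc)))

countTrue-onlyAt : {n : ℕ} (α : Fin n → Bool) (i : Fin n) → OnlyAt α i → countTrue α ≡ 1
countTrue-onlyAt α zero (α0 , rest) =
  trans (countTrue-suc α) (cong₂ _+_ (cong bit α0) (countTrue-none (α ∘ suc) λ k → rest (suc k) λ ()))
countTrue-onlyAt α (suc i) (αi , rest) =
  trans (countTrue-suc α) (cong₂ _+_ (cong bit (rest zero λ ()))
    (countTrue-onlyAt (α ∘ suc) i (αi , λ k k≢i → rest (suc k) (k≢i ∘ suc-injective))))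

countTrue-pos : {n : ℕ} (α : Fin n → Bool) (i : Fin n) → α i ≡ true → 1 ≤ countTrue α
countTrue-pos α zero    α0 rewrite countTrue-suc α | α0 = s≤s z≤n
countTrue-pos α (suc i) αi rewrite countTrue-suc α = ≤-trans (countTrue-pos (α ∘ suc) i αi) (m≤n+m _ _)

countTrue-two : {n : ℕ} (α : Fin n → Bool) (i j : Fin n) → i ≢ j → α i ≡ true → α j ≡ true → 2 ≤ countTrue α
countTrue-two α zero    zero    0≢0 _ _ = contradiction refl 0≢0
countTrue-two α zero    (suc j) _ α0 αj rewrite countTrue-suc α | α0 = s≤s (countTrue-pos (α ∘ suc) j αj)
countTrue-two α (suc i) zero    _ αi α0 rewrite countTrue-suc α | α0 = s≤s (countTrue-pos (α ∘ suc) i αi)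
countTrue-two α (suc i) (suc j) i≢j αi αj rewrite countTrue-suc α =
  ≤-trans (countTrue-two (α ∘ suc) i j (i≢j ∘ cong suc) αi αj) (m≤n+m _ _)

≤1⇒onlyAt : {n : ℕ} (α : Fin n → Bool) {i : Fin n} → countTrue α ≤ 1 → α i ≡ true → OnlyAt α i
≤1⇒onlyAt α {i} ≤1 αi = αi , λ k k≢i → ¬-not λ αk →
  1+n≰n (≤-trans (countTrue-two α i k (k≢i ∘ sym) αi αk) ≤1)

unique⇒≤1 : {n : ℕ} (α : Fin n → Bool) → (∀ i j → α i ≡ true → α j ≡ true → i ≡ j) → countTrue α ≤ 1
unique⇒≤1 α unique with someTrue? α
... | inj₂ none     = ≤-trans (≤-reflexive (countTrue-none α none)) z≤n
... | inj₁ (i , αi) = ≤-reflexive (countTrue-onlyAt α i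
        (αi , λ k k≢i → ¬-not λ αk → k≢i (unique k i αk αi)))

AMO⇒≤1 : {n : ℕ} (α : Fin n → Bool) → AMO n α ≡ true → countTrue α ≤ 1
AMO⇒≤1 α p = ≤ᵇ⇒≤ (countTrue α) 1 (Equivalence.from T-≡ p)

≤1⇒AMO : {n : ℕ} (α : Fin n → Bool) → countTrue α ≤ 1 → AMO n α ≡ true
≤1⇒AMO α p = Equivalence.to T-≡ (≤⇒≤ᵇ p)

EO⇒≡1 : {n : ℕ} (α : Fin n → Bool) → EO n α ≡ true → countTrue α ≡ 1
EO⇒≡1 α p = ≡ᵇ⇒≡ (countTrue α) 1 (Equivalence.from T-≡ p)

≡1⇒EO : {n : ℕ} (α : Fin n → Bool) → countTrue α ≡ 1 → EO n α ≡ true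
≡1⇒EO α p = Equivalence.to T-≡ (≡⇒≡ᵇ (countTrue α) 1 p)

-- f accepts every unit vector, and only vectors with at most one 1; AMO_n and EO_n are the
-- extreme cases.
record Sandwiched {n : ℕ} (f : (Fin n → Bool) → Bool) : Set where
  field
    accepts-unitVec : ∀ i → f (unitVec i) ≡ true
    atMostOne       : ∀ α → f α ≡ true → countTrue α ≤ 1

AMO-sandwiched : (n : ℕ) → Sandwiched (AMO n)
AMO-sandwiched n = record
  { accepts-unitVec = λ i → ≤1⇒AMO (unitVec i) (≤-reflexive (countTrue-onlyAt (unitVec i) i (unitVec-onlyAt i)))
  ; atMostOne       = AMO⇒≤1
  }

EO-sandwiched : (n : ℕ) → Sandwiched (EO n)
EO-sandwiched n = record
  { accepts-unitVec = λ i → ≡1⇒EO (unitVec i) (countTrue-onlyAt (unitVec i) i (unitVec-onlyAt i))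
  ; atMostOne       = λ α p → ≤-reflexive (EO⇒≡1 α p)
  }

Entails : {n : ℕ} → ((Fin n → Bool) → Bool) → List (ILit n) → ILit n → Set
Entails {n} f gs h = (α : Fin n → Bool) → f α ≡ true → All (LitTrue α) gs → LitTrue α h

litTrue? : {n : ℕ} (α : Fin n → Bool) (g : ILit n) → Dec (LitTrue α g)
litTrue? α (k , b) = α k ≟ᵇ b

Negative : {n : ℕ} → ILit n → Set
Negative (_ , b) = b ≡ false

unitVec-satisfies : {n : ℕ} {gs : List (ILit n)} (k : Fin n) → All Negative gs → (k , false) ∉ gs →
                    All (LitTrue (unitVec k)) gs
unitVec-satisfies {gs = gs} k neg ¬xk∉gs = All.tabulate λ { {j , b} g∈gs → satisfied j b g∈gs (All.lookup neg g∈gs) }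
  where
  satisfied : ∀ j b → (j , b) ∈ gs → b ≡ false → unitVec k j ≡ b
  satisfied j .false g∈gs refl = proj₂ (unitVec-onlyAt k) j λ { refl → ¬xk∉gs g∈gs }

negative-consequence : {n : ℕ} {f : (Fin n → Bool) → Bool} {gs : List (ILit n)} {j : Fin n} →
                       (∀ i → f (unitVec i) ≡ true) → All Negative gs → Entails f gs (j , false) →
                       (j , false) ∈ gs
negative-consequence {gs = gs} {j} accepts neg entails with (j , false) ∈? gs
  where open DecMembership (≡-dec _≟ᶠ_ _≟ᵇ_) using (_∈?_)
... | yes ¬xj∈gs = ¬xj∈gs
... | no ¬xj∉gs with () ← trans (sym (unitVec-self j))
                            (entails (unitVec j) (accepts j) (unitVec-satisfies j neg ¬xj∉gs))

module _ {n ℓ : ℕ} where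

  assume : CNF (Var n ℓ) → List (ILit n) → CNF (Var n ℓ)
  assume φ gs = withUnits φ (map liftLit gs)

  Propagates : CNF (Var n ℓ) → List (ILit n) → ILit n → Set
  Propagates φ gs h = (assume φ gs ⊢₁ liftLit h) ⊎ (assume φ gs ⊢₁⊥)

  Exclusive : CNF (Var n ℓ) → Set
  Exclusive φ = ∀ i j → i ≢ j → assume φ ((i , true) ∷ []) ⊢₁ (inj₁ j , false)

  assume-unit : {φ : CNF (Var n ℓ)} {gs : List (ILit n)} {g : ILit n} → g ∈ gs → (liftLit g ∷ []) ∈ assume φ gs
  assume-unit {φ} g∈gs = ∈-++⁺ʳ φ (∈-map⁺ (_∷ []) (∈-map⁺ liftLit g∈gs))

  assume-derives : {φ : CNF (Var n ℓ)} {gs : List (ILit n)} {g : ILit n} → g ∈ gs → assume φ gs ⊢₁ liftLit g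
  assume-derives {g = g} g∈gs = liftLit g ∷ [] , axiom (assume-unit g∈gs) , unit-singleton (liftLit g)

  assume-mono : {φ φ' : CNF (Var n ℓ)} {gs : List (ILit n)} → (∀ {C} → C ∈ φ → C ∈ φ') →
                ∀ {C} → C ∈ assume φ gs → C ∈ assume φ' gs
  assume-mono {φ} {φ'} φ⊆φ' C∈ with ∈-++⁻ φ C∈
  ... | inj₁ C∈φ     = ∈-++⁺ˡ (φ⊆φ' C∈φ)
  ... | inj₂ C∈units = ∈-++⁺ʳ φ' C∈units

  assume-single : {φ : CNF (Var n ℓ)} {gs : List (ILit n)} {g : ILit n} → g ∈ gs →
                  ∀ {C} → C ∈ assume φ (g ∷ []) → C ∈ assume φ gs
  assume-single {φ} g∈gs C∈ with ∈-++⁻ φ C∈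
  ... | inj₁ C∈φ       = ∈-++⁺ˡ C∈φ
  ... | inj₂ (here refl) = assume-unit g∈gs

  propagate-unitVec : {φ : CNF (Var n ℓ)} {gs : List (ILit n)} {i : Fin n} → Exclusive φ → (i , true) ∈ gs →
                      (h : ILit n) → LitTrue (unitVec i) h → assume φ gs ⊢₁ liftLit h
  propagate-unitVec {i = i} excl xi∈gs (j , true) eij with refl ← unitVec-true⇒ {i = i} {j} eij = assume-derives xi∈gs
  propagate-unitVec {i = i} excl xi∈gs (j , false) eij =
    ⊢₁-weaken (assume-single xi∈gs) (excl i j λ { refl → not-¬ (unitVec-self i) eij })

  -- Case of a positive assumption x_i: if e_i satisfies all assumptions, it satisfies h, which
  -- is therefore propagated; otherwise some assumption g fails at e_i, and ¬g is propagated.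
  positive-case : {f : (Fin n → Bool) → Bool} {φ : CNF (Var n ℓ)} {gs : List (ILit n)} {i : Fin n} →
                  (∀ i → f (unitVec i) ≡ true) → Exclusive φ → (i , true) ∈ gs →
                  (h : ILit n) → Entails f gs h → Propagates φ gs h
  positive-case {gs = gs} {i} accepts excl xi∈gs h entails with all? (litTrue? (unitVec i)) gs
  ... | yes gs-true = inj₁ (propagate-unitVec excl xi∈gs h (entails (unitVec i) (accepts i) gs-true))
  ... | no gs-fail with find (¬All⇒Any¬ (litTrue? (unitVec i)) gs gs-fail)
  ... | (k , b) , g∈gs , g-false =
        inj₂ (clash (assume-derives g∈gs) (propagate-unitVec excl xi∈gs (k , not b) (¬-not g-false)))

  pc-criterion : {f : (Fin n → Bool) → Bool} {φ : CNF (Var n ℓ)} →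
                 (∀ i → f (unitVec i) ≡ true) → Exclusive φ →
                 (∀ gs h → All Negative gs → Entails f gs h → Propagates φ gs h) →
                 ∀ gs h → Entails f gs h → Propagates φ gs h
  pc-criterion accepts excl negative-case gs h entails with any? (λ g → proj₂ g ≟ᵇ true) gs
  ... | yes some with (i , .true) , xi∈gs , refl ← find some = positive-case accepts excl xi∈gs h entails
  ... | no none = negative-case gs h (All.map ¬-not (¬Any⇒All¬ gs none)) entails

-- For AMO_n a positive literal is never entailed by
-- negative assumptions (the zero vector satisfies them); for EO_n the literal x_j is entailed
-- only if ¬x_k is assumed for every k ≠ j, and then it follows by resolving x_1 ∨ … ∨ x_n.

module _ {n ℓ : ℕ} where

  AMO-negative-case : {φ : CNF (Var n ℓ)} → ∀ gs h → All Negative gs → Entails (AMO n) gs h → Propagates φ gs h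
  AMO-negative-case gs (j , false) neg entails =
    inj₁ (assume-derives (negative-consequence (Sandwiched.accepts-unitVec (AMO-sandwiched n)) neg entails))
  AMO-negative-case gs (j , true) neg entails
    with () ← entails (λ _ → false) (≤1⇒AMO {n} (λ _ → false) (unique⇒≤1 {n} (λ _ → false) λ _ _ ()))
                      (All.map (λ { {k , b} → sym }) neg)

  allInputs : Clause (Var n ℓ)
  allInputs = map (λ k → (inj₁ k , true)) (allFin n)

  EO-negative-case : {φ : CNF (Var n ℓ)} → allInputs ∈ φ →
                     ∀ gs h → All Negative gs → Entails (EO n) gs h → Propagates φ gs h
  EO-negative-case _ gs (j , false) neg entails =
    inj₁ (assume-derives (negative-consequence (Sandwiched.accepts-unitVec (EO-sandwiched n)) neg entails))
  EO-negative-case all∈φ gs (j , true) neg entails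
    with C' , d' , sub ← resolveAway (axiom (∈-++⁺ˡ all∈φ)) (All.map⁺ (All.tabulate assume-derives)) =
    derived-unit-or-empty d' only-xj
    where
    open Sandwiched (EO-sandwiched n)
    only-xj : ∀ {m} → m ∈ C' → m ≡ (inj₁ j , true)
    only-xj m∈C' with sub m∈C'
    ... | m∈all , m-kept with ∈-map⁻ _ m∈all
    ... | k , _ , refl =
      let ¬xk∉gs : (k , false) ∉ gs
          ¬xk∉gs ¬xk∈gs = All.lookup (All.map⁻ m-kept) ¬xk∈gs refl
      in cong (λ i → (inj₁ i , true)) (sym (unitVec-true⇒ (entails (unitVec k) (accepts-unitVec k)
                                                          (unitVec-satisfies k neg ¬xk∉gs))))

HasPCEncodingOfSize : {n : ℕ} → ((Fin n → Bool) → Bool) → ℕ → Set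
HasPCEncodingOfSize {n} f s = ∃[ ℓ ] Σ[ φ ∈ CNF (Var n ℓ) ] (IsPCEncoding f φ × length φ ≡ s)

-- Each e_i extends to a model (P1), and since f ∧ x_i ⊨ ¬x_j, propagation completeness
-- yields (P2), a contradiction being excluded by that model.
pc⇒P : {n ℓ : ℕ} {f : (Fin n → Bool) → Bool} → Sandwiched f → (φ : CNF (Var n ℓ)) → IsPCEncoding f φ → IsPEncoding φ
pc⇒P {n} sw φ ((wf , encodes) , complete) = wf , model , exclusive
  where
  open Sandwiched sw
  model : (i : Fin n) → ∃[ a ] CNFTrue a (assume φ ((i , true) ∷ []))
  model i with β , t ← Equivalence.to (encodes (unitVec i)) (accepts-unitVec i) =
    [ unitVec i , β ] , All.++⁺ t (here (unitVec-self i) ∷ [])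
  exclusive : Exclusive φ
  exclusive i j i≢j with complete ((i , true) ∷ []) (λ ()) (j , false)
                           (λ { α fα (αi ∷ []) → proj₂ (≤1⇒onlyAt α (atMostOne α fα) αi) j (i≢j ∘ sym) })
  ... | inj₁ propagated = propagated
  ... | inj₂ conflict   = contradiction conflict (sound-⊥ (proj₂ (model i)))

module PEncoding {n ℓ : ℕ} {ψ : CNF (Var n ℓ)} (pe : IsPEncoding ψ) where

  exclusive : Exclusive ψ
  exclusive = proj₂ (proj₂ pe)

  true-unique : {a : Var n ℓ → Bool} → CNFTrue a ψ → ∀ i j → a (inj₁ i) ≡ true → a (inj₁ j) ≡ true → i ≡ j
  true-unique t i j ai aj with i ≟ᶠ j
  ... | yes i≡j = i≡j
  ... | no i≢j  = contradiction (sound-lit (All.++⁺ t (here ai ∷ [])) (exclusive i j i≢j)) (not-¬ aj)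

  extend : (γ : Fin n → Bool) (i : Fin n) → OnlyAt γ i → ∃[ β ] CNFTrue [ γ , β ] ψ
  extend γ i γ-only with a , t ← proj₁ (proj₂ pe) i =
    a ∘ inj₂ , CNFTrue-cong agree ψ tψ
    where
    tψ : CNFTrue a ψ
    tψ = All.++⁻ˡ ψ t
    ai : a (inj₁ i) ≡ true
    ai with here ai ∷ [] ← All.++⁻ʳ ψ t = ai
    agree : a ≗ [ γ , a ∘ inj₂ ]
    agree (inj₁ k) = onlyAt-unique (ai , λ k k≢i → ¬-not λ ak → k≢i (true-unique tψ k i ak ai)) γ-only k
    agree (inj₂ j) = refl

module EOFromP {n ℓ : ℕ} {ψ : CNF (Var n ℓ)} (pe : IsPEncoding ψ) where
  open PEncoding pe

  φEO : CNF (Var n ℓ)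
  φEO = ψ ++ allInputs ∷ []

  wellFormed : WellFormed φEO
  wellFormed = All.++⁺ (proj₁ pe) ((λ v (_ , ¬v∈) → no-negative ¬v∈) ∷ [])
    where
    no-negative : {v : Var n ℓ} → (v , false) ∉ allInputs
    no-negative ¬v∈ with () ← ∈-map⁻ _ ¬v∈

  encodes : (α : Fin n → Bool) → (EO n α ≡ true) ⇔ (∃[ β ] CNFTrue [ α , β ] φEO)
  encodes α = mk⇔ to from
    where
    to : EO n α ≡ true → ∃[ β ] CNFTrue [ α , β ] φEO
    to eo with someTrue? α
    ... | inj₂ none = contradiction (trans (sym (countTrue-none α none)) (EO⇒≡1 α eo)) λ ()
    ... | inj₁ (i , αi) with β , t ← extend α i (≤1⇒onlyAt α (≤-reflexive (EO⇒≡1 α eo)) αi) =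
          β , All.++⁺ t (lose (∈-map⁺ _ (∈-allFin i)) αi ∷ [])
    from : ∃[ β ] CNFTrue [ α , β ] φEO → EO n α ≡ true
    from (β , t) with find (All.head (All.++⁻ʳ ψ t))
    ... | m , m∈ , m-true with ∈-map⁻ _ m∈
    ... | i , _ , refl = ≡1⇒EO α
          (≤-antisym (unique⇒≤1 α (true-unique (All.++⁻ˡ ψ t))) (countTrue-pos α i m-true))

  pc : IsPCEncoding (EO n) φEO
  pc = (wellFormed , encodes) , λ gs _ → pc-criterion accepts-unitVec exclusive-φEO (EO-negative-case all∈φEO) gs
    where
    open Sandwiched (EO-sandwiched n)
    exclusive-φEO : Exclusive φEO
    exclusive-φEO i j i≢j = ⊢₁-weaken (assume-mono {φ = ψ} {φEO} ∈-++⁺ˡ) (exclusive i j i≢j)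
    all∈φEO : allInputs ∈ φEO
    all∈φEO = ∈-++⁺ʳ ψ (here refl)

  has-size : HasPCEncodingOfSize (EO n) (suc (length ψ))
  has-size = ℓ , φEO , pc , length-snoc ψ allInputs

-- Upper bound for AMO_n: rename x_0 in ψ to a fresh auxiliary variable y_0 and add the bridge
-- clause ¬x_0 ∨ y_0. A model may set y_0 = 1 when all inputs are 0, which is what AMO_n adds
-- to EO_n; unit propagation passes x_0 to y_0 and ¬y_0 back to ¬x_0.

module AMOFromP {m ℓ : ℕ} {ψ : CNF (Var (suc m) ℓ)} (pe : IsPEncoding ψ) where
  open PEncoding pe

  ρ : Var (suc m) ℓ → Var (suc m) (suc ℓ)
  ρ (inj₁ zero)    = inj₂ zero
  ρ (inj₁ (suc k)) = inj₁ (suc k)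
  ρ (inj₂ j)       = inj₂ (suc j)

  ρ⁻¹ : Var (suc m) (suc ℓ) → Var (suc m) ℓ
  ρ⁻¹ (inj₁ k)       = inj₁ k
  ρ⁻¹ (inj₂ zero)    = inj₁ zero
  ρ⁻¹ (inj₂ (suc j)) = inj₂ j

  ρ⁻¹∘ρ : ∀ v → ρ⁻¹ (ρ v) ≡ v
  ρ⁻¹∘ρ (inj₁ zero)    = refl
  ρ⁻¹∘ρ (inj₁ (suc k)) = refl
  ρ⁻¹∘ρ (inj₂ j)       = refl

  open Rename ρ (λ {u} {v} ρu≡ρv → trans (sym (ρ⁻¹∘ρ u)) (trans (cong ρ⁻¹ ρu≡ρv) (ρ⁻¹∘ρ v)))

  x₀ y₀ : Var (suc m) (suc ℓ)
  x₀ = inj₁ zero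
  y₀ = inj₂ zero

  bridge : Clause (Var (suc m) (suc ℓ))
  bridge = (x₀ , false) ∷ (y₀ , true) ∷ []

  φAMO : CNF (Var (suc m) (suc ℓ))
  φAMO = renCNF ψ ++ bridge ∷ []

  wellFormed : WellFormed φAMO
  wellFormed = All.++⁺ (rename-wellFormed (proj₁ pe)) (bridge-wf ∷ [])
    where
    bridge-wf : (v : Var (suc m) (suc ℓ)) → ¬ ((v , true) ∈ bridge × (v , false) ∈ bridge)
    bridge-wf v (there (here refl) , there (here ()))

  models⁺ : (a : Var (suc m) (suc ℓ) → Bool) → CNFTrue (a ∘ ρ) ψ → (a x₀ ≡ true → a y₀ ≡ true) → CNFTrue a φAMO
  models⁺ a t x₀⇒y₀ = All.++⁺ (rename-sat⁺ a t) (bridge-true (a x₀) refl ∷ [])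
    where
    bridge-true : ∀ b → a x₀ ≡ b → ClauseTrue a bridge
    bridge-true false ax₀ = here ax₀
    bridge-true true  ax₀ = there (here (x₀⇒y₀ ax₀))

  -- The input vector seen by ψ: α with its first coordinate replaced by the value z of y_0.
  replace₀ : Bool → (Fin (suc m) → Bool) → Fin (suc m) → Bool
  replace₀ z α zero    = z
  replace₀ z α (suc k) = α (suc k)

  extend-y₀ : Bool → (Fin ℓ → Bool) → Fin (suc ℓ) → Bool
  extend-y₀ z β zero    = z
  extend-y₀ z β (suc j) = β j

  pullback : (z : Bool) (α : Fin (suc m) → Bool) (β : Fin ℓ → Bool) →
             [ α , extend-y₀ z β ] ∘ ρ ≗ [ replace₀ z α , β ]
  pullback z α β (inj₁ zero)    = refl
  pullback z α β (inj₁ (suc k)) = refl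
  pullback z α β (inj₂ j)       = refl

  extend-AMO : (α : Fin (suc m) → Bool) (z : Bool) (i : Fin (suc m)) →
               OnlyAt (replace₀ z α) i → (α zero ≡ true → z ≡ true) → ∃[ β ] CNFTrue [ α , β ] φAMO
  extend-AMO α z i only x₀⇒z with β , t ← extend (replace₀ z α) i only =
    extend-y₀ z β , models⁺ _ (CNFTrue-cong (λ v → sym (pullback z α β v)) ψ t) x₀⇒z

  encodes : (α : Fin (suc m) → Bool) → (AMO (suc m) α ≡ true) ⇔ (∃[ β ] CNFTrue [ α , β ] φAMO)
  encodes α = mk⇔ to from
    where
    to : AMO (suc m) α ≡ true → ∃[ β ] CNFTrue [ α , β ] φAMO
    to amo with someTrue? (α ∘ suc)
    ... | inj₁ (k , αk) =
          extend-AMO α false (suc k) (αk , λ { zero _ → refl ; (suc j) j≢k → rest (suc j) j≢k })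
            λ α₀ → contradiction α₀ (not-¬ (rest zero λ ()))
      where rest = proj₂ (≤1⇒onlyAt α (AMO⇒≤1 α amo) αk)
    ... | inj₂ none = extend-AMO α true zero (refl , λ { zero 0≢0 → contradiction refl 0≢0 ; (suc j) _ → none j })
                        λ _ → refl
    from : ∃[ β ] CNFTrue [ α , β ] φAMO → AMO (suc m) α ≡ true
    from (β , t) = ≤1⇒AMO α (unique⇒≤1 α λ i j αi αj →
      true-unique (rename-sat⁻ a (All.++⁻ˡ (renCNF ψ) t)) i j (lift i αi) (lift j αj))
      where
      a : Var (suc m) (suc ℓ) → Bool
      a = [ α , β ]
      lift : ∀ k → α k ≡ true → a (ρ (inj₁ k)) ≡ true
      lift (suc k) αk = αk
      lift zero    α₀ with All.++⁻ʳ (renCNF ψ) t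
      ... | here ¬α₀ ∷ []        = contradiction α₀ (not-¬ ¬α₀)
      ... | there (here y₀-true) ∷ [] = y₀-true

  bridge-forward : {Δ : CNF (Var (suc m) (suc ℓ))} → bridge ∈ Δ → Δ ⊢₁ (x₀ , true) → Δ ⊢₁ (y₀ , true)
  bridge-forward b∈ (U , dU , unit) = _ , resolve dU unit (axiom b∈) (here refl) , unit-singleton _

  bridge-backward : {Δ : CNF (Var (suc m) (suc ℓ))} → bridge ∈ Δ → Δ ⊢₁ (y₀ , false) → Δ ⊢₁ (x₀ , false)
  bridge-backward b∈ (U , dU , unit) = _ , resolve dU unit (axiom b∈) (there (here refl)) , unit-singleton _

  -- Exclusivity survives the renaming: ψ's propagation from x_i is replayed in φAMO, with the
  -- bridge translating between x_0 and y_0 at both ends.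
  exclusive-φAMO : Exclusive φAMO
  exclusive-φAMO i j i≢j = unrename j (⊢₁-compose replay (rename-⊢₁ (exclusive i j i≢j)))
    where
    Γ : CNF (Var (suc m) (suc ℓ))
    Γ = assume φAMO ((i , true) ∷ [])
    b∈Γ : bridge ∈ Γ
    b∈Γ = ∈-++⁺ˡ (∈-++⁺ʳ (renCNF ψ) (here refl))
    xi : Γ ⊢₁ (inj₁ i , true)
    xi = assume-derives (here refl)
    renamed-xi : (i' : Fin (suc m)) → i' ≡ i → Γ ⊢ᵘ (renLit (inj₁ i' , true) ∷ [])
    renamed-xi zero    refl = proj₁ (proj₂ (bridge-forward b∈Γ xi))
    renamed-xi (suc k) refl = axiom (assume-unit (here refl))
    replay : ∀ {C} → C ∈ renCNF (assume ψ ((i , true) ∷ [])) → Γ ⊢ᵘ C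
    replay C∈ with ∈-map⁻ renClause C∈
    ... | D , D∈ , refl with ∈-++⁻ ψ D∈
    ... | inj₁ D∈ψ       = axiom (∈-++⁺ˡ (∈-++⁺ˡ (∈-map⁺ renClause D∈ψ)))
    ... | inj₂ (here refl) = renamed-xi i refl
    unrename : (j' : Fin (suc m)) → Γ ⊢₁ renLit (inj₁ j' , false) → Γ ⊢₁ (inj₁ j' , false)
    unrename zero    = bridge-backward b∈Γ
    unrename (suc k) d = d

  pc : IsPCEncoding (AMO (suc m)) φAMO
  pc = (wellFormed , encodes) , λ gs _ →
    pc-criterion (Sandwiched.accepts-unitVec (AMO-sandwiched (suc m))) exclusive-φAMO AMO-negative-case gs

  has-size : HasPCEncodingOfSize (AMO (suc m)) (suc (length ψ))
  has-size = suc ℓ , φAMO , pc , trans (length-snoc (renCNF ψ) bridge) (cong suc (length-map renClause ψ))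

smallest-≤ : {n ℓ s : ℕ} {f : (Fin n → Bool) → Bool} {φ : CNF (Var n ℓ)} →
             IsSmallestPCEncoding f φ → HasPCEncodingOfSize f s → length φ ≤ s
smallest-≤ (_ , smallest) (ℓ' , ψ , pc , refl) = smallest ℓ' ψ pc

proposition1 : (n : ℕ) → 2 ≤ n → (s : ℕ) → IsMinPEncodingSize n s →
    (ℓ₁ : ℕ) (φ₁ : CNF (Var n ℓ₁)) → IsSmallestPCEncoding (AMO n) φ₁ →
    (ℓ₂ : ℕ) (φ₂ : CNF (Var n ℓ₂)) → IsSmallestPCEncoding (EO n) φ₂ →
    (s ≤ length φ₁ × length φ₁ ≤ suc s) × (s ≤ length φ₂ × length φ₂ ≤ suc s)
proposition1 (suc m) _ .(length ψ) ((ℓ , ψ , pe , refl) , minimum) ℓ₁ φ₁ smallest₁ ℓ₂ φ₂ smallest₂ =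
  (minimum ℓ₁ φ₁ (pc⇒P (AMO-sandwiched (suc m)) φ₁ (proj₁ smallest₁)) , smallest-≤ smallest₁ (AMOFromP.has-size pe)) ,
  (minimum ℓ₂ φ₂ (pc⇒P (EO-sandwiched (suc m)) φ₂ (proj₁ smallest₂)) , smallest-≤ smallest₂ (EOFromP.has-size pe))
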